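{- Let $f:\mathbb{B}^n\to\mathbb{B}^n$ be a Boolean network in which component $n$ is not autoregulated, with reduction $\tilde f$ by elimination of $n$ and representative map $\sigma$. Let $\mathrm{D}\in\{\mathrm{AD},\mathrm{GD}\}$. If $A\subseteq\mathbb{B}^n$ is a trap set for $\mathrm{D}(f)$, then $A_{[n-1]}$ is a trap set for $\mathrm{D}(\tilde f)$. Moreover, $\sigma(x)\in A$ for all $x\in A_{[n-1]}$.
   Context: $\mathbb{B}=\{0,1\}$, $[n]=\{1,\dots,n\}$. For $x\in\mathbb{B}^n$, $\bar x^i$ is $x$ with coordinate $i$ flipped. Component $i$ regulates $j$ if $f_j(x)\neq f_j(\bar x^i)$ for some $x$; $n$ is autoregulated if it regulates itself. Reduction: if $n$ is not autoregulated, $\sigma(x)=(x,f_n(x,0))\in\mathbb{B}^n$ for $x\in\mathbb{B}^{n-1}$ and $\tilde f:\mathbb{B}^{n-1}\to\mathbb{B}^{n-1}$, $\tilde f_i(x)=f_i(\sigma(x))$. $A_{[n-1]}$ is the projection of $A$ onto the first $n-1$ coordinates. Dynamics of a network $g$ on $\mathbb{B}^m$ are directed graphs on $\mathbb{B}^m$: the asynchronous dynamics $\mathrm{AD}(g)$ has transitions $x\to \bar x^i$ whenever $g_i(x)\neq x_i$; the general asynchronous dynamics $\mathrm{GD}(g)$ has transitions $x\to y$ whenever $y\neq x$ and $y_i\neq x_i\Rightarrow y_i=g_i(x)$ for all $i$. A trap set is a set of states with no outgoing transitions to states outside it. -}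

module Defs where

open import Data.Bool using (Bool; true; false; not)
open import Data.Nat using (ℕ; suc)
open import Data.Fin using (Fin; fromℕ)
open import Data.Vec using (Vec; lookup; _[_]%=_; _∷ʳ_; init)
open import Data.Product using (Σ; ∃; _×_)
open import Relation.Binary.PropositionalEquality using (_≡_; _≢_)
open import Relation.Nullary using (¬_)

State : ℕ → Set
State n = Vec Bool n

BN : ℕ → Set
BN n = State n → State n

flip : ∀ {n} → Fin n → State n → State n
flip i x = x [ i ]%= not

Regulates : ∀ {n} → BN n → Fin n → Fin n → Set
Regulates f i j = ∃ λ x → lookup (f x) j ≢ lookup (f (flip i x)) j

-- Last component (component n of B^(m+1), n = m+1) is autoregulated.
LastAutoregulated : ∀ {m} → BN (suc m) → Set
LastAutoregulated {m} f = Regulates f (fromℕ m) (fromℕ m)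

σ : ∀ {m} → BN (suc m) → State m → State (suc m)
σ {m} f x = x ∷ʳ lookup (f (x ∷ʳ false)) (fromℕ m)

reduce : ∀ {m} → BN (suc m) → BN m
reduce f x = init (f (σ f x))

StateSet : ℕ → Set₁
StateSet n = State n → Set

project : ∀ {m} → StateSet (suc m) → StateSet m
project A x = ∃ λ b → A (x ∷ʳ b)

Dynamics : ℕ → Set₁
Dynamics n = State n → State n → Set

AD : ∀ {n} → BN n → Dynamics n
AD g x y = ∃ λ i → (lookup (g x) i ≢ lookup x i) × (y ≡ flip i x)

GD : ∀ {n} → BN n → Dynamics n
GD g x y = (y ≢ x) × (∀ i → lookup y i ≢ lookup x i → lookup y i ≡ lookup (g x) i)

data Mode : Set where
  async general : Mode

Dyn : Mode → ∀ {n} → BN n → Dynamics n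
Dyn async   = AD
Dyn general = GD

TrapSet : ∀ {n} → Dynamics n → StateSet n → Set
TrapSet D A = ∀ x y → A x → D x y → A y

-- Since component n does not regulate itself, f_n(x, b) = f_n(x, 0) for both
-- values of b, so σ(x) is the state above x whose last coordinate is already
-- stable. From any (x, b) in A one therefore either is at σ(x) or reaches it in
-- one transition of the last coordinate, and the trap set contains σ(x).
-- A transition x → y of the reduced network only changes the first n - 1
-- coordinates, and f̃(x) agrees with f(σ(x)) there, so it lifts to the
-- transition σ(x) → (y, σ(x)_n) of the original network, which stays in A.
module Submission where

open import Defs
open import Data.Bool using (Bool; true; false; not)
open import Data.Bool.Properties using (_≟_; ¬-not)
open import Data.Fin using (Fin; fromℕ; inject₁; zero; suc)
open import Data.Nat using (ℕ; zero; suc)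
open import Data.Product using (_×_; _,_)
open import Data.Vec using (Vec; []; _∷_; lookup; _∷ʳ_; init)
open import Data.Vec.Properties using (∷ʳ-injectiveˡ; ∷ʳ-injectiveʳ)
open import Function using (_∘_)
open import Relation.Binary.PropositionalEquality
open import Relation.Nullary using (¬_; yes; no; contradiction)
open import Relation.Nullary.Decidable using (decidable-stable)

private
  variable
    A : Set
    m : ℕ

lookup-∷ʳ-inject₁ : ∀ (xs : Vec A m) x i → lookup (xs ∷ʳ x) (inject₁ i) ≡ lookup xs i
lookup-∷ʳ-inject₁ (y ∷ xs) x zero    = refl
lookup-∷ʳ-inject₁ (y ∷ xs) x (suc i) = lookup-∷ʳ-inject₁ xs x i

lookup-∷ʳ-fromℕ : ∀ (xs : Vec A m) x → lookup (xs ∷ʳ x) (fromℕ m) ≡ x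
lookup-∷ʳ-fromℕ []       x = refl
lookup-∷ʳ-fromℕ (y ∷ xs) x = lookup-∷ʳ-fromℕ xs x

lookup-init : ∀ (xs : Vec A (suc m)) i → lookup (init xs) i ≡ lookup xs (inject₁ i)
lookup-init (x ∷ xs) zero    = refl
lookup-init (x ∷ xs) (suc i) = lookup-init xs i

flip-∷ʳ-inject₁ : ∀ (x : State m) b i → flip (inject₁ i) (x ∷ʳ b) ≡ flip i x ∷ʳ b
flip-∷ʳ-inject₁ (y ∷ x) b zero    = refl
flip-∷ʳ-inject₁ (y ∷ x) b (suc i) = cong (y ∷_) (flip-∷ʳ-inject₁ x b i)

flip-∷ʳ-fromℕ : ∀ (x : State m) b → flip (fromℕ m) (x ∷ʳ b) ≡ x ∷ʳ not b
flip-∷ʳ-fromℕ []      b = refl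
flip-∷ʳ-fromℕ (y ∷ x) b = cong (y ∷_) (flip-∷ʳ-fromℕ x b)

data LastView : Fin (suc m) → Set where
  inject : (i : Fin m) → LastView (inject₁ i)
  last   : LastView (fromℕ m)

lastView : (j : Fin (suc m)) → LastView j
lastView {zero}  zero    = last
lastView {suc m} zero    = inject zero
lastView {suc m} (suc j) with lastView j
... | inject i = inject (suc i)
... | last     = last

lift-transition : ∀ D (g : BN (suc m)) (h : BN m) {x y b} →
                  h x ≡ init (g (x ∷ʳ b)) →
                  Dyn D h x y → Dyn D g (x ∷ʳ b) (y ∷ʳ b)
lift-transition async g h {x} {b = b} hx≡g (i , hx≢x , refl) =
  inject₁ i , g≢x , sym (flip-∷ʳ-inject₁ x b i)
  where
  g≢x : lookup (g (x ∷ʳ b)) (inject₁ i) ≢ lookup (x ∷ʳ b) (inject₁ i)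
  g≢x e = hx≢x (begin
    lookup (h x) i                     ≡⟨ cong (λ v → lookup v i) hx≡g ⟩
    lookup (init (g (x ∷ʳ b))) i       ≡⟨ lookup-init (g (x ∷ʳ b)) i ⟩
    lookup (g (x ∷ʳ b)) (inject₁ i)    ≡⟨ e ⟩
    lookup (x ∷ʳ b) (inject₁ i)        ≡⟨ lookup-∷ʳ-inject₁ x b i ⟩
    lookup x i                         ∎)
    where open ≡-Reasoning
lift-transition general g h {x} {y} {b} hx≡g (y≢x , y-follows-h) =
  (λ e → y≢x (∷ʳ-injectiveˡ y x e)) , follows
  where
  follows : ∀ j → lookup (y ∷ʳ b) j ≢ lookup (x ∷ʳ b) j →
            lookup (y ∷ʳ b) j ≡ lookup (g (x ∷ʳ b)) j
  follows j moved with lastView j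
  ... | inject i = begin
    lookup (y ∷ʳ b) (inject₁ i)        ≡⟨ lookup-∷ʳ-inject₁ y b i ⟩
    lookup y i                         ≡⟨ y-follows-h i y≢x-at-i ⟩
    lookup (h x) i                     ≡⟨ cong (λ v → lookup v i) hx≡g ⟩
    lookup (init (g (x ∷ʳ b))) i       ≡⟨ lookup-init (g (x ∷ʳ b)) i ⟩
    lookup (g (x ∷ʳ b)) (inject₁ i)    ∎
    where
    open ≡-Reasoning
    y≢x-at-i : lookup y i ≢ lookup x i
    y≢x-at-i e = moved (trans (lookup-∷ʳ-inject₁ y b i)
                         (trans e (sym (lookup-∷ʳ-inject₁ x b i))))
  ... | last = contradiction (trans (lookup-∷ʳ-fromℕ y b) (sym (lookup-∷ʳ-fromℕ x b))) moved

last-transition : ∀ D (g : BN (suc m)) x b →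
                  lookup (g (x ∷ʳ b)) (fromℕ m) ≢ b →
                  Dyn D g (x ∷ʳ b) (x ∷ʳ lookup (g (x ∷ʳ b)) (fromℕ m))
last-transition async g x b gₙ≢b =
  fromℕ _ , (λ e → gₙ≢b (trans e (lookup-∷ʳ-fromℕ x b))) ,
  trans (cong (x ∷ʳ_) (¬-not gₙ≢b)) (sym (flip-∷ʳ-fromℕ x b))
last-transition general g x b gₙ≢b =
  (λ e → gₙ≢b (∷ʳ-injectiveʳ x x e)) , follows
  where
  gₙ : Bool
  gₙ = lookup (g (x ∷ʳ b)) (fromℕ _)
  follows : ∀ j → lookup (x ∷ʳ gₙ) j ≢ lookup (x ∷ʳ b) j →
            lookup (x ∷ʳ gₙ) j ≡ lookup (g (x ∷ʳ b)) j
  follows j moved with lastView j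
  ... | inject i = contradiction (trans (lookup-∷ʳ-inject₁ x gₙ i)
                                   (sym (lookup-∷ʳ-inject₁ x b i))) moved
  ... | last     = lookup-∷ʳ-fromℕ x gₙ

last-independent : (f : BN (suc m)) → ¬ LastAutoregulated f → ∀ x b →
                   lookup (f (x ∷ʳ b)) (fromℕ m) ≡ lookup (f (x ∷ʳ false)) (fromℕ m)
last-independent f _       x false = refl
last-independent {m} f ¬auto x true = begin
  lookup (f (x ∷ʳ true)) (fromℕ m)                    ≡⟨ unregulated ⟩
  lookup (f (flip (fromℕ m) (x ∷ʳ true))) (fromℕ m)   ≡⟨ cong (λ v → lookup (f v) (fromℕ m)) (flip-∷ʳ-fromℕ x true) ⟩
  lookup (f (x ∷ʳ false)) (fromℕ m)                   ∎
  where
  open ≡-Reasoning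
  unregulated : lookup (f (x ∷ʳ true)) (fromℕ m) ≡ lookup (f (flip (fromℕ m) (x ∷ʳ true))) (fromℕ m)
  unregulated = decidable-stable (_ ≟ _) (λ ne → ¬auto (x ∷ʳ true , ne))

σ-∈-trap : ∀ D (f : BN (suc m)) (A : StateSet (suc m)) → ¬ LastAutoregulated f →
           TrapSet (Dyn D f) A → ∀ x b → A (x ∷ʳ b) → A (σ f x)
σ-∈-trap {m} D f A ¬auto trap x b a with b ≟ lookup (f (x ∷ʳ false)) (fromℕ m)
... | yes refl = a
... | no  b≢fₙ = trap (x ∷ʳ b) (σ f x) a
  (subst (Dyn D f (x ∷ʳ b) ∘ (x ∷ʳ_)) (last-independent f ¬auto x b)
    (last-transition D f x b λ e → b≢fₙ (trans (sym e) (last-independent f ¬auto x b))))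

project-trap : ∀ D (f : BN (suc m)) (A : StateSet (suc m)) → ¬ LastAutoregulated f →
               TrapSet (Dyn D f) A → TrapSet (Dyn D (reduce f)) (project A)
project-trap {m} D f A ¬auto trap x y (b , a) x→y =
  lookup (f (x ∷ʳ false)) (fromℕ m) ,
  trap (σ f x) _ (σ-∈-trap D f A ¬auto trap x b a) (lift-transition D f (reduce f) refl x→y)

lemma2 : (m : ℕ) (f : BN (suc m)) → ¬ LastAutoregulated f →
         (D : Mode) (A : StateSet (suc m)) →
         TrapSet (Dyn D f) A →
         TrapSet (Dyn D (reduce f)) (project A) × (∀ x → project A x → A (σ f x))
lemma2 m f ¬auto D A trap =
  project-trap D f A ¬auto trap , λ x (b , a) → σ-∈-trap D f A ¬auto trap x b a
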